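{- Let $(S,=,\#,\cdot;\tau)$ be a co-quasiordered semigroup with apartness. Then: (i) $\kappa_\tau=\tau\cup\tau^{ -1}$ is a co-congruence on $S$; (ii) $(S/\kappa_\tau^c,=,\#,\cdot)$ is a semigroup with apartness, where $x\kappa_\tau^c=y\kappa_\tau^c\iff(x,y)\in{\sim}\kappa_\tau$, $x\kappa_\tau^c\#y\kappa_\tau^c\iff(x,y)\in\kappa_\tau$, and $x\kappa_\tau^c\cdot y\kappa_\tau^c=(xy)\kappa_\tau^c$; (iii) $(S/\kappa_\tau^c,=,\#,\cdot;\Upsilon_\tau)$ is a co-ordered semigroup with apartness, where $(x\kappa_\tau^c,y\kappa_\tau^c)\in\Upsilon_\tau\iff(x,y)\in\tau$; (iv) the quotient map $\pi_\tau:S\to S/\kappa_\tau^c$, $\pi_\tau(x)=x\kappa_\tau^c$, is an isotone and reverse isotone se-epimorphism.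
   Context: Constructive (Bishop-style) setting. A set with apartness: inhabited set with equality $=$ (an equivalence) and $\#$ with $\neg(x\#x)$, $x\#y\Rightarrow y\#x$, $x\#z\Rightarrow\forall y(x\#y\vee y\#z)$, extensional w.r.t. $=$; $S\times S$ has apartness $(s,t)\#(u,v)\iff s\#u\vee t\#v$. A semigroup with apartness is a set with apartness with an associative operation satisfying $ax\#by\Rightarrow(a\#b\vee x\#y)$. A relation $\alpha$ is strongly irreflexive if $(x,y)\in\alpha\Rightarrow x\#y$; co-transitive if $(x,y)\in\alpha\Rightarrow\forall z((x,z)\in\alpha\vee(z,y)\in\alpha)$; co-antisymmetric if $x\#y\Rightarrow(x,y)\in\alpha\vee(y,x)\in\alpha$; co-compatible if $(xz,yt)\in\alpha\Rightarrow(x,y)\in\alpha\vee(z,t)\in\alpha$. Co-quasiorder: strongly irreflexive and co-transitive; co-order: co-antisymmetric co-quasiorder; co-congruence: symmetric co-compatible co-quasiorder. A co-quasiordered (co-ordered) semigroup with apartness is a semigroup with apartness with a co-compatible co-quasiorder (co-order). ${\sim}\alpha=\{(x,y):\forall(a,b)\in\alpha\,((x,y)\#(a,b))\}$, written $\alpha^c$ for co-quasiorders. Isotone: $(x,y)\in\tau\Rightarrow(\pi_\tau(x),\pi_\tau(y))\in\Upsilon_\tau$; reverse isotone: converse. An se-epimorphism is a surjective homomorphism $g$ with $g(x)\#g(y)\Rightarrow x\#y$. -}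

module Defs where

open import Level using (Level; _⊔_)
open import Data.Product using (Σ; _×_; _,_)
open import Data.Sum using (_⊎_)
open import Relation.Nullary using (¬_)
open import Relation.Binary.Core using (Rel)
open import Relation.Binary.Structures using (IsEquivalence)

private
  variable
    a b ℓ₁ ℓ₂ ℓ₃ ℓ₄ ℓ₅ ℓ₆ : Level

record IsSetWithApartness {A : Set a} (_≈_ : Rel A ℓ₁) (_#_ : Rel A ℓ₂)
       : Set (a ⊔ ℓ₁ ⊔ ℓ₂) where
  field
    inhabited   : A
    isEquivalence : IsEquivalence _≈_
    #-irrefl    : ∀ x → ¬ (x # x)
    #-sym       : ∀ {x y} → x # y → y # x
    #-cotrans   : ∀ {x z} → x # z → ∀ y → (x # y) ⊎ (y # z)
    #-ext       : ∀ {x x' y y'} → x ≈ x' → y ≈ y' → x # y → x' # y'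

record IsSemigroupWithApartness {A : Set a} (_≈_ : Rel A ℓ₁) (_#_ : Rel A ℓ₂)
       (_∙_ : A → A → A) : Set (a ⊔ ℓ₁ ⊔ ℓ₂) where
  field
    isSetWithApartness : IsSetWithApartness _≈_ _#_
    ∙-cong   : ∀ {x x' y y'} → x ≈ x' → y ≈ y' → (x ∙ y) ≈ (x' ∙ y')
    assoc    : ∀ x y z → ((x ∙ y) ∙ z) ≈ (x ∙ (y ∙ z))
    ∙-strext : ∀ {a x b y} → (a ∙ x) # (b ∙ y) → (a # b) ⊎ (x # y)

_#²_ : {A : Set a} → Rel A ℓ₂ → Rel (A × A) ℓ₂
(_#_ #² (s , t)) (u , v) = (s # u) ⊎ (t # v)

StronglyIrreflexive : {A : Set a} → Rel A ℓ₂ → Rel A ℓ₃ → Set (a ⊔ ℓ₂ ⊔ ℓ₃)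
StronglyIrreflexive _#_ α = ∀ {x y} → α x y → x # y

CoTransitive : {A : Set a} → Rel A ℓ₃ → Set (a ⊔ ℓ₃)
CoTransitive α = ∀ {x y} → α x y → ∀ z → α x z ⊎ α z y

CoAntisymmetric : {A : Set a} → Rel A ℓ₂ → Rel A ℓ₃ → Set (a ⊔ ℓ₂ ⊔ ℓ₃)
CoAntisymmetric _#_ α = ∀ {x y} → x # y → α x y ⊎ α y x

CoCompatible : {A : Set a} → (A → A → A) → Rel A ℓ₃ → Set (a ⊔ ℓ₃)
CoCompatible _∙_ α = ∀ {x y z t} → α (x ∙ z) (y ∙ t) → α x y ⊎ α z t

Symmetric : {A : Set a} → Rel A ℓ₃ → Set (a ⊔ ℓ₃)
Symmetric α = ∀ {x y} → α x y → α y x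

record IsCoQuasiorder {A : Set a} (_#_ : Rel A ℓ₂) (α : Rel A ℓ₃)
       : Set (a ⊔ ℓ₂ ⊔ ℓ₃) where
  field
    strongIrrefl : StronglyIrreflexive _#_ α
    coTrans      : CoTransitive α

record IsCoOrder {A : Set a} (_#_ : Rel A ℓ₂) (α : Rel A ℓ₃)
       : Set (a ⊔ ℓ₂ ⊔ ℓ₃) where
  field
    isCoQuasiorder : IsCoQuasiorder _#_ α
    coAntisym      : CoAntisymmetric _#_ α

record IsCoCongruence {A : Set a} (_#_ : Rel A ℓ₂) (_∙_ : A → A → A)
       (α : Rel A ℓ₃) : Set (a ⊔ ℓ₂ ⊔ ℓ₃) where
  field
    isCoQuasiorder : IsCoQuasiorder _#_ α
    sym            : Symmetric α
    coCompat       : CoCompatible _∙_ α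

record IsCoQuasiorderedSemigroup {A : Set a} (_≈_ : Rel A ℓ₁) (_#_ : Rel A ℓ₂)
       (_∙_ : A → A → A) (τ : Rel A ℓ₃) : Set (a ⊔ ℓ₁ ⊔ ℓ₂ ⊔ ℓ₃) where
  field
    isSemigroupWithApartness : IsSemigroupWithApartness _≈_ _#_ _∙_
    isCoQuasiorder           : IsCoQuasiorder _#_ τ
    coCompat                 : CoCompatible _∙_ τ

record IsCoOrderedSemigroup {A : Set a} (_≈_ : Rel A ℓ₁) (_#_ : Rel A ℓ₂)
       (_∙_ : A → A → A) (τ : Rel A ℓ₃) : Set (a ⊔ ℓ₁ ⊔ ℓ₂ ⊔ ℓ₃) where
  field
    isSemigroupWithApartness : IsSemigroupWithApartness _≈_ _#_ _∙_
    isCoOrder                : IsCoOrder _#_ τ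
    coCompat                 : CoCompatible _∙_ τ

∼ : {A : Set a} → Rel A ℓ₂ → Rel A ℓ₃ → Rel A (a ⊔ ℓ₂ ⊔ ℓ₃)
∼ _#_ α x y = ∀ u v → α u v → (_#_ #² (x , y)) (u , v)

κ : {A : Set a} → Rel A ℓ₃ → Rel A ℓ₃
κ τ x y = τ x y ⊎ τ y x

-- The quotient S/κ_τ^c is represented as a setoid-style quotient: its
-- elements are represented by elements x of S (standing for x κ_τ^c), with
--   x κ^c = y κ^c  ⇔ (x,y) ∈ ∼κ_τ,
--   x κ^c # y κ^c  ⇔ (x,y) ∈ κ_τ,
--   x κ^c · y κ^c  = (xy) κ^c.
QEq : {A : Set a} → Rel A ℓ₂ → Rel A ℓ₃ → Rel A (a ⊔ ℓ₂ ⊔ ℓ₃)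
QEq _#_ τ = ∼ _#_ (κ τ)

QApart : {A : Set a} → Rel A ℓ₃ → Rel A ℓ₃
QApart τ = κ τ

Υ : {A : Set a} → Rel A ℓ₃ → Rel A ℓ₃
Υ τ x y = τ x y

π : {A : Set a} → A → A
π x = x

Isotone : {A : Set a} {B : Set b} → Rel A ℓ₃ → Rel B ℓ₄ → (A → B) → Set (a ⊔ ℓ₃ ⊔ ℓ₄)
Isotone ρ σ g = ∀ {x y} → ρ x y → σ (g x) (g y)

ReverseIsotone : {A : Set a} {B : Set b} → Rel A ℓ₃ → Rel B ℓ₄ → (A → B) → Set (a ⊔ ℓ₃ ⊔ ℓ₄)
ReverseIsotone ρ σ g = ∀ {x y} → σ (g x) (g y) → ρ x y

record IsSEEpimorphism {A : Set a} {B : Set b}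
       (_≈₁_ : Rel A ℓ₁) (_#₁_ : Rel A ℓ₂) (_∙₁_ : A → A → A)
       (_≈₂_ : Rel B ℓ₄) (_#₂_ : Rel B ℓ₅) (_∙₂_ : B → B → B)
       (g : A → B) : Set (a ⊔ b ⊔ ℓ₁ ⊔ ℓ₂ ⊔ ℓ₄ ⊔ ℓ₅) where
  field
    cong       : ∀ {x y} → x ≈₁ y → g x ≈₂ g y
    homo       : ∀ x y → g (x ∙₁ y) ≈₂ (g x ∙₂ g y)
    surjective : ∀ q → Σ A (λ x → g x ≈₂ q)
    strongExt  : ∀ {x y} → g x #₂ g y → x #₁ y

{-# OPTIONS --safe #-}
module Submission where

-- For a co-quasiorder α the relation ∼α is just the complement ¬α: one
-- direction is irreflexivity of #, the other is co-transitivity of α applied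
-- twice.  Hence, for a co-congruence α, ∼α is an equivalence compatible with
-- the operation, and α is an apartness for it; the quotient S/α^c is then a
-- semigroup with apartness onto which x ↦ x is an se-epimorphism.  κ_τ is
-- such a co-congruence, and τ is a co-order on S/κ_τ^c because every pair
-- apart there lies in τ or τ⁻¹ by definition.

open import Defs
open import Level using (Level)
open import Data.Product using (_×_; _,_)
open import Data.Sum using (inj₁; inj₂; [_,_]; swap; map)
open import Function using (id)
open import Relation.Nullary using (¬_; contradiction)
open import Relation.Binary.Core using (Rel)
open import Relation.Binary.Structures using (IsEquivalence)

private
  variable
    a ℓ₁ ℓ₂ ℓ₃ : Level
    S : Set a

κ-symmetric : (τ : Rel S ℓ₃) → Symmetric (κ τ)
κ-symmetric τ = swap

κ-coCompatible : {_∙_ : S → S → S} {τ : Rel S ℓ₃} →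
                 CoCompatible _∙_ τ → CoCompatible _∙_ (κ τ)
κ-coCompatible coCompat (inj₁ p) = map inj₁ inj₁ (coCompat p)
κ-coCompatible coCompat (inj₂ p) = map inj₂ inj₂ (coCompat p)

κ-isCoQuasiorder : {_#_ : Rel S ℓ₂} {τ : Rel S ℓ₃} →
                   Symmetric _#_ →
                   IsCoQuasiorder _#_ τ → IsCoQuasiorder _#_ (κ τ)
κ-isCoQuasiorder #-sym isCoQuasiorder = record
  { strongIrrefl = [ strongIrrefl , (λ p → #-sym (strongIrrefl p)) ]
  ; coTrans      = coTrans′ }
  where
  open IsCoQuasiorder isCoQuasiorder
  coTrans′ : CoTransitive (κ _)
  coTrans′ (inj₁ p) z = map inj₁ inj₁ (coTrans p z)
  coTrans′ (inj₂ p) z = swap (map inj₂ inj₂ (coTrans p z))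

module CoQuasiorderComplement
    {_≈_ : Rel S ℓ₁} {_#_ : Rel S ℓ₂} {α : Rel S ℓ₃}
    (apartness : IsSetWithApartness _≈_ _#_)
    (isCoQuasiorder : IsCoQuasiorder _#_ α) where

  open IsSetWithApartness apartness
  open IsCoQuasiorder isCoQuasiorder
  private module ≈ = IsEquivalence isEquivalence

  ∼⇒¬ : ∀ {x y} → ∼ _#_ α x y → ¬ α x y
  ∼⇒¬ {x} {y} x∼y αxy = [ #-irrefl x , #-irrefl y ] (x∼y x y αxy)

  ¬⇒∼ : ∀ {x y} → ¬ α x y → ∼ _#_ α x y
  ¬⇒∼ {x} {y} ¬αxy u v αuv with coTrans αuv x
  ... | inj₁ αux = inj₁ (#-sym (strongIrrefl αux))
  ... | inj₂ αxv with coTrans αxv y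
  ...   | inj₁ αxy = contradiction αxy ¬αxy
  ...   | inj₂ αyv = inj₂ (strongIrrefl αyv)

  ≈⇒∼ : ∀ {x y} → x ≈ y → ∼ _#_ α x y
  ≈⇒∼ {x} {y} x≈y = ¬⇒∼ λ αxy → #-irrefl y (#-ext x≈y ≈.refl (strongIrrefl αxy))

  ∼-refl : ∀ {x} → ∼ _#_ α x x
  ∼-refl = ≈⇒∼ ≈.refl

  ∼-trans : ∀ {x y z} → ∼ _#_ α x y → ∼ _#_ α y z → ∼ _#_ α x z
  ∼-trans {y = y} x∼y y∼z = ¬⇒∼ λ αxz → [ ∼⇒¬ x∼y , ∼⇒¬ y∼z ] (coTrans αxz y)

  ∙-cong-∼ : {_∙_ : S → S → S} → CoCompatible _∙_ α →
             ∀ {x x′ y y′} → ∼ _#_ α x x′ → ∼ _#_ α y y′ →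
             ∼ _#_ α (x ∙ y) (x′ ∙ y′)
  ∙-cong-∼ coCompat x∼x′ y∼y′ =
    ¬⇒∼ λ α∙ → [ ∼⇒¬ x∼x′ , ∼⇒¬ y∼y′ ] (coCompat α∙)

  module Symmetric (α-sym : Symmetric α) where

    ∼-sym : ∀ {x y} → ∼ _#_ α x y → ∼ _#_ α y x
    ∼-sym x∼y = ¬⇒∼ λ αyx → ∼⇒¬ x∼y (α-sym αyx)

    ∼-isEquivalence : IsEquivalence (∼ _#_ α)
    ∼-isEquivalence = record { refl = ∼-refl ; sym = ∼-sym ; trans = ∼-trans }

    α-resp-∼ : ∀ {x x′ y y′} → ∼ _#_ α x x′ → ∼ _#_ α y y′ → α x y → α x′ y′
    α-resp-∼ {x′ = x′} {y′ = y′} x∼x′ y∼y′ αxy with coTrans αxy x′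
    ... | inj₁ αxx′ = contradiction αxx′ (∼⇒¬ x∼x′)
    ... | inj₂ αx′y with coTrans αx′y y′
    ...   | inj₁ αx′y′ = αx′y′
    ...   | inj₂ αy′y = contradiction (α-sym αy′y) (∼⇒¬ y∼y′)

module QuotientByCoCongruence
    {_≈_ : Rel S ℓ₁} {_#_ : Rel S ℓ₂} {_∙_ : S → S → S} {α : Rel S ℓ₃}
    (semigroup : IsSemigroupWithApartness _≈_ _#_ _∙_)
    (isCoCongruence : IsCoCongruence _#_ _∙_ α) where

  open IsSemigroupWithApartness semigroup
  open IsSetWithApartness isSetWithApartness
  open IsCoCongruence isCoCongruence
    renaming (isCoQuasiorder to α-isCoQuasiorder; sym to α-sym)
  open IsCoQuasiorder α-isCoQuasiorder
  open CoQuasiorderComplement isSetWithApartness α-isCoQuasiorder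
  open Symmetric α-sym

  quotient-isSemigroupWithApartness : IsSemigroupWithApartness (∼ _#_ α) α _∙_
  quotient-isSemigroupWithApartness = record
    { isSetWithApartness = record
      { inhabited     = inhabited
      ; isEquivalence = ∼-isEquivalence
      ; #-irrefl      = λ x αxx → #-irrefl x (strongIrrefl αxx)
      ; #-sym         = α-sym
      ; #-cotrans     = coTrans
      ; #-ext         = α-resp-∼ }
    ; ∙-cong   = ∙-cong-∼ coCompat
    ; assoc    = λ x y z → ≈⇒∼ (assoc x y z)
    ; ∙-strext = coCompat }

  π-isSEEpimorphism : IsSEEpimorphism _≈_ _#_ _∙_ (∼ _#_ α) α _∙_ π
  π-isSEEpimorphism = record
    { cong       = ≈⇒∼
    ; homo       = λ x y → ∼-refl
    ; surjective = λ q → q , ∼-refl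
    ; strongExt  = strongIrrefl }

lemma17 : ∀ {a ℓ₁ ℓ₂ ℓ₃} {S : Set a} {_≈_ : Rel S ℓ₁} {_#_ : Rel S ℓ₂}
            {_∙_ : S → S → S} {τ : Rel S ℓ₃} →
            IsCoQuasiorderedSemigroup _≈_ _#_ _∙_ τ →
            IsCoCongruence _#_ _∙_ (κ τ)
            × IsSemigroupWithApartness (QEq _#_ τ) (QApart τ) _∙_
            × IsCoOrderedSemigroup (QEq _#_ τ) (QApart τ) _∙_ (Υ τ)
            × Isotone τ (Υ τ) π
            × ReverseIsotone τ (Υ τ) π
            × IsSEEpimorphism _≈_ _#_ _∙_ (QEq _#_ τ) (QApart τ) _∙_ π
lemma17 {_#_ = _#_} {_∙_ = _∙_} {τ = τ} H =
  κ-isCoCongruence , quotient-isSemigroupWithApartness , Υ-isCoOrderedSemigroup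
  , id , id , π-isSEEpimorphism
  where
  open IsCoQuasiorderedSemigroup H
  open IsSemigroupWithApartness isSemigroupWithApartness
  open IsSetWithApartness isSetWithApartness

  κ-isCoCongruence : IsCoCongruence _#_ _∙_ (κ τ)
  κ-isCoCongruence = record
    { isCoQuasiorder = κ-isCoQuasiorder #-sym isCoQuasiorder
    ; sym            = κ-symmetric τ
    ; coCompat       = κ-coCompatible {_∙_ = _∙_} {τ = τ} coCompat }

  open QuotientByCoCongruence isSemigroupWithApartness κ-isCoCongruence

  Υ-isCoOrderedSemigroup : IsCoOrderedSemigroup (QEq _#_ τ) (QApart τ) _∙_ (Υ τ)
  Υ-isCoOrderedSemigroup = record
    { isSemigroupWithApartness = quotient-isSemigroupWithApartness
    ; isCoOrder = record
      { isCoQuasiorder = record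
        { strongIrrefl = inj₁
        ; coTrans      = IsCoQuasiorder.coTrans isCoQuasiorder }
      ; coAntisym = id }
    ; coCompat = coCompat }
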